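{- Let $n \geq 2$, let $G$ be the disjoint union of cycles $C_{k_1},\ldots,C_{k_n}$ with each $k_i \geq 3$, and suppose there exist distinct $a, b \in [n]$ with $k_a = k_b = 4$. Let $M = K_1 \vee G$. Then $P_{DP}(M,4) < P(M,4)$. Consequently, $\tau_{DP}(M) \geq 5$.
   Context: All graphs are finite and simple; $K_1 \vee G$ is the join of a single vertex with $G$. A cover of a graph $G$ is a pair $\mathcal{H}=(L,H)$ where $H$ is a graph and $L: V(G) \to \mathcal{P}(V(H))$ satisfies: (1) $\{L(u): u \in V(G)\}$ is a partition of $V(H)$ into $|V(G)|$ parts; (2) $H[L(u)]$ is complete for each $u$; (3) if there is an edge of $H$ between $L(u)$ and $L(v)$ with $u \neq v$, then $uv \in E(G)$; (4) if $uv \in E(G)$, the edges of $H$ between $L(u)$ and $L(v)$ form a (possibly empty) matching. The cover is $m$-fold if $|L(u)|=m$ for all $u$. An $\mathcal{H}$-coloring is an independent set of $H$ of size $|V(G)|$. $P_{DP}(G,m)$ is the minimum number of $\mathcal{H}$-colorings over all $m$-fold covers; $P(G,m)$ is the chromatic polynomial. $\tau_{DP}(G)$ is the smallest $N \geq \chi(G)$ such that $P_{DP}(G,m)=P(G,m)$ for all $m \geq N$ (and $\infty$ if no such $N$ exists). -}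

module Defs where

open import Data.Nat using (ℕ; zero; suc; _+_; _≤_; _<_; _≡ᵇ_)
open import Data.Bool using (Bool; true; false; _∧_; _∨_; not)
open import Data.Fin using (Fin; zero; suc; toℕ; splitAt; _≟_)
open import Data.Fin.Subset using (Subset; ∣_∣)
open import Data.Vec using (Vec; []; _∷_; lookup)
open import Data.List using (List; []; _∷_; length; filter; map; concatMap; allFin)
open import Data.Sum using (inj₁; inj₂)
open import Data.Product using (Σ; _×_)
open import Relation.Nullary using (¬_; does)
open import Relation.Binary.PropositionalEquality using (_≡_; _≢_)

-- A graph has vertex set Fin size and a raw
-- Boolean relation 'adj'; its edge relation is the symmetric,
-- irreflexive closure 'edge'.  Every finite simple graph (up to
-- relabelling the vertices as Fin size) arises this way.

record Graph : Set where
  field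
    size : ℕ
    adj  : Fin size → Fin size → Bool
open Graph public

edge : (G : Graph) → Fin (size G) → Fin (size G) → Bool
edge G i j = not (does (i ≟ j)) ∧ (adj G i j ∨ adj G j i)

-- cycle C_k on vertices 0,…,k-1 (a genuine cycle when k ≥ 3)
cycle : ℕ → Graph
cycle k = record { size = k ; adj = λ i j →
  (suc (toℕ i) ≡ᵇ toℕ j) ∨ ((suc (toℕ i) ≡ᵇ k) ∧ (toℕ j ≡ᵇ 0)) }

emptyGraph : Graph
emptyGraph = record { size = 0 ; adj = λ () }

_⊕_ : Graph → Graph → Graph
G ⊕ H = record { size = size G + size H ; adj = a }
  where
  a : Fin (size G + size H) → Fin (size G + size H) → Bool
  a i j with splitAt (size G) i | splitAt (size G) j
  ... | inj₁ x | inj₁ y = adj G x y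
  ... | inj₂ x | inj₂ y = adj H x y
  ... | _      | _      = false

K1∨_ : Graph → Graph
K1∨ G = record { size = suc (size G) ; adj = a }
  where
  a : Fin (suc (size G)) → Fin (suc (size G)) → Bool
  a zero    (suc _) = true
  a (suc i) (suc j) = adj G i j
  a _       _       = false

cycles : ∀ {n} → Vec ℕ n → Graph
cycles []       = emptyGraph
cycles (k ∷ ks) = cycle k ⊕ cycles ks

allVecs : {A : Set} → List A → (n : ℕ) → List (Vec A n)
allVecs xs zero    = [] ∷ []
allVecs xs (suc n) = concatMap (λ x → map (x ∷_) (allVecs xs n)) xs

allB : {A : Set} → (A → Bool) → List A → Bool
allB p []       = true
allB p (x ∷ xs) = p x ∧ allB p xs

countB : {A : Set} → (A → Bool) → List A → ℕ
countB p []       = 0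
countB p (x ∷ xs) with p x
... | true  = suc (countB p xs)
... | false = countB p xs

properB : (G : Graph) {m : ℕ} → Vec (Fin m) (size G) → Bool
properB G f = allB (λ i → allB (λ j →
  not (edge G i j ∧ does (lookup f i ≟ lookup f j))) (allFin (size G))) (allFin (size G))

P : Graph → ℕ → ℕ
P G m = countB (properB G) (allVecs (allFin m) (size G))

Colorable : Graph → ℕ → Set
Colorable G N = Σ (Fin (size G) → Fin N) λ f →
  ∀ i j → edge G i j ≡ true → f i ≢ f j

-- m-fold covers (DP-colouring)
-- H is a graph on Fin K; L maps each vertex of H to the vertex u of G
-- whose list L(u) contains it (so {L(u)} partitions V(H)).

record Cover (G : Graph) (m : ℕ) : Set where
  field
    H    : Graph
    part : Fin (size H) → Fin (size G)
    mfold : ∀ u → length (filter (λ x → part x ≟ u) (allFin (size H))) ≡ m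
    clique : ∀ x y → part x ≡ part y → x ≢ y → edge H x y ≡ true
    overEdge : ∀ x y → part x ≢ part y → edge H x y ≡ true →
               edge G (part x) (part y) ≡ true
    matching : ∀ x y z → part x ≢ part y → part y ≡ part z →
               edge H x y ≡ true → edge H x z ≡ true → y ≡ z
open Cover public

independentB : (H : Graph) → Subset (size H) → Bool
independentB H S = allB (λ x → allB (λ y →
  not (lookup S x ∧ lookup S y ∧ edge H x y)) (allFin (size H))) (allFin (size H))

-- number of H-colourings: independent sets of H of size |V(G)|
#colorings : ∀ {G m} → Cover G m → ℕ
#colorings {G} c = countB
  (λ S → does (∣ S ∣ Data.Nat.≟ size G) ∧ independentB (H c) S)
  (allVecs (true ∷ false ∷ []) (size (H c)))

IsPDP : Graph → ℕ → ℕ → Set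
IsPDP G m k = Σ (Cover G m) (λ c → #colorings c ≡ k) × (∀ (c : Cover G m) → k ≤ #colorings c)

-- N is an admissible value in the definition of τ_DP(G):
-- N ≥ χ(G) and P_DP(G,m) = P(G,m) for all m ≥ N.
TauAdmissible : Graph → ℕ → Set
TauAdmissible G N = Colorable G N × (∀ m → N ≤ m → IsPDP G m (P G m))

-- In the cover, every edge of M = K₁ ∨ G is straight except the closing edges of the two 4-cycles C_a
-- and C_b, twisted by the colour transpositions (2 3) and (0 1); its colourings are the maps g with
-- g(v) ≠ σ_uv(g(u)) on every edge.  Fix the colour x of the apex.  One of the two transpositions
-- permutes the three remaining colours and the other moves x, and a 4-cycle with one edge twisted by
-- them has 16, respectively 20, colourings avoiding x, against 18 proper ones; the 20 are the 18
-- proper ones and 2 others.  Sending (b, s) to (b, β s) if b is proper and to (β s, d b) otherwise,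
-- with β mapping the 16 onto 16 proper colourings and d the 2 others onto the remaining 2 ("reserved")
-- ones, injects the colourings of C_a ∪ C_b into pairs of proper colourings and misses every pair
-- (r , r) with r reserved.  Keeping the other cycles as they are, this injects the colourings of the
-- cover into the proper 4-colourings of M and misses one of them.

module Submission where

open import Defs
open import Data.Bool using (Bool; true; false; T; T?; _∧_; _∨_; not; if_then_else_)
open import Data.Bool.Properties using (T-≡; T-not-≡; T-∧; T-∨; ∧-comm; ∨-comm; ∧-zeroʳ)
open import Data.Nat using (ℕ; zero; suc; _+_; _∸_; _*_; _≤_; _<_; z≤n; s≤s; _≡ᵇ_; _≤ᵇ_)
import Data.Nat as ℕ
open import Data.Nat.Properties
  using (1+n≰n; ≡ᵇ⇒≡; <-irrefl; ≤-refl; ≤-trans; ≤-antisym; +-mono-≤; n≤1+n; <⇒≱; module ≤-Reasoning)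
open import Data.Fin using (Fin; zero; suc; toℕ; _≟_; _↑ˡ_; _↑ʳ_; splitAt; cast; combine; quotient; remainder)
open import Data.Fin.Properties
  using (toℕ<n; toℕ-cast; cast-is-id; cast-involutive; remQuot-combine; combine-remQuot; combine-injectiveʳ;
         splitAt-↑ˡ; splitAt-↑ʳ; splitAt⁻¹-↑ˡ; splitAt⁻¹-↑ʳ; ↑ˡ-injective; ↑ʳ-injective)
open import Data.Fin.Permutation.Components using (transpose)
open import Data.Fin.Subset using (Subset; ⁅_⁆; ⊥; ∣_∣; Nonempty) renaming (_∈_ to _∈ˢ_)
open import Data.Fin.Subset.Properties using (nonempty?; Empty-unique; ∣⊥∣≡0; ∣⁅x⁆∣≡1; x∈⁅x⁆; p⊆q⇒∣p∣≤∣q∣)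
open import Data.Vec using (Vec; []; _∷_; _++_; lookup; tabulate)
import Data.Vec as Vec
open import Data.Vec.Properties
  using (∷-injective; ≡-dec; lookup∘tabulate; tabulate∘lookup; tabulate-cong; lookup-++ˡ; lookup-++ʳ;
         []=⇒lookup; lookup⇒[]=)
open import Data.List
  using (List; []; _∷_; allFin; length; map; concatMap; filter; filterᵇ; cartesianProductWith)
import Data.List as List
open import Data.List.Properties using (length-map; length-tabulate; filter-notAll)
open import Data.List.Membership.Propositional using (_∈_)
open import Data.List.Membership.Propositional.Properties
  using (∈-filter⁺; ∈-filter⁻; ∈-map⁻; ∈-cartesianProductWith⁺; ∈-allFin; ∈-tabulate⁺; ∈-tabulate⁻)
open import Data.List.Relation.Unary.All as All using (All; []; _∷_)
open import Data.List.Relation.Unary.Any as Any using (here; there)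
open import Data.List.Relation.Unary.AllPairs using ([]; _∷_)
open import Data.List.Relation.Unary.Unique.Propositional using (Unique)
import Data.List.Relation.Unary.Unique.Propositional.Properties as Unique
open import Data.List.Relation.Binary.Subset.Propositional using (_⊆_)
open import Data.Product using (Σ; _×_; _,_; proj₁; proj₂; uncurry; swap)
open import Data.Sum using (_⊎_; inj₁; inj₂; [_,_]′)
open import Function using (id; _∘_; _⇔_; mk⇔; Equivalence)
open import Relation.Nullary using (¬_; ¬?; Dec; does; yes; no; contradiction)
open import Relation.Nullary.Decidable using (dec-true; dec-false; does-⇔; decidable-stable)
open import Relation.Binary.Definitions using (DecidableEquality)
open import Relation.Binary.PropositionalEquality
  using (_≡_; _≢_; refl; sym; trans; cong; cong₂; subst; subst₂; module ≡-Reasoning)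

T-does : ∀ {P : Set} (P? : Dec P) → T (does P?) ⇔ P
T-does (yes p) = mk⇔ (λ _ → p) (λ _ → _)
T-does (no ¬p) = mk⇔ (λ ()) ¬p

T-not-does : ∀ {P : Set} (P? : Dec P) → T (not (does P?)) ⇔ (¬ P)
T-not-does (yes p) = mk⇔ (λ ()) (λ ¬p → ¬p p)
T-not-does (no ¬p) = mk⇔ (λ _ → ¬p) (λ _ → _)

T-not : ∀ {a} → T (not a) ⇔ (¬ T a)
T-not {true}  = mk⇔ (λ ()) (λ ¬t → ¬t _)
T-not {false} = mk⇔ (λ _ ()) (λ _ → _)

T-implies : ∀ {a b} → T (not a ∨ b) ⇔ (T a → T b)
T-implies {true}  = mk⇔ (λ tb _ → tb) (λ f → f _)
T-implies {false} = mk⇔ (λ _ ()) (λ _ → _)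

if-elim : ∀ {A : Set} (P : A → Set) b {t e : A} → (b ≡ true → P t) → (b ≡ false → P e) → P (if b then t else e)
if-elim P true  on-true _        = on-true refl
if-elim P false _       on-false = on-false refl

bool-cases : ∀ b {R : Set} → (b ≡ true → R) → (b ≡ false → R) → R
bool-cases true  on-true _        = on-true refl
bool-cases false _       on-false = on-false refl

-- Counting by injection

countB≡length-filter : ∀ {A : Set} (p : A → Bool) xs → countB p xs ≡ length (filter (T? ∘ p) xs)
countB≡length-filter p [] = refl
countB≡length-filter p (x ∷ xs) with p x
... | true  = cong suc (countB≡length-filter p xs)
... | false = countB≡length-filter p xs

Unique∧⊆⇒length≤ : ∀ {A : Set} → DecidableEquality A → {xs ys : List A} →
                   Unique xs → xs ⊆ ys → length xs ≤ length ys
Unique∧⊆⇒length≤ _≟_ {[]} _ _ = z≤n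
Unique∧⊆⇒length≤ _≟_ {x ∷ xs} {ys} (x∉xs ∷ xs!) x∷xs⊆ys = begin
  suc (length xs)             ≤⟨ s≤s (Unique∧⊆⇒length≤ _≟_ xs! xs⊆ys-x) ⟩
  suc (length (filter ≢x? ys)) ≤⟨ filter-notAll ≢x? ys (Any.map (λ x≡y x≢y → x≢y x≡y) (x∷xs⊆ys (here refl))) ⟩
  length ys                   ∎
  where
  open ≤-Reasoning
  ≢x? = ¬? ∘ (x ≟_)
  xs⊆ys-x : xs ⊆ filter ≢x? ys
  xs⊆ys-x y∈xs = ∈-filter⁺ ≢x? (x∷xs⊆ys (there y∈xs)) λ { refl → All.lookup x∉xs y∈xs refl }

map⁺-injectiveOn : ∀ {A B : Set} {f : A → B} {xs : List A} → Unique xs →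
                   (∀ {x x′} → x ∈ xs → x′ ∈ xs → f x ≡ f x′ → x ≡ x′) → Unique (map f xs)
map⁺-injectiveOn {xs = []} _ _ = []
map⁺-injectiveOn {f = f} {xs = x ∷ xs} (x∉xs ∷ xs!) f-inj =
  All.tabulate (λ fy∈ fx≡fy → let (y , y∈ , fy≡) = ∈-map⁻ f fy∈ in
                  All.lookup x∉xs y∈ (f-inj (here refl) (there y∈) (trans fx≡fy fy≡)))
  ∷ map⁺-injectiveOn xs! (λ x∈ x′∈ → f-inj (there x∈) (there x′∈))

countB-<-by-injection :
  ∀ {A B : Set} → DecidableEquality B → {p : A → Bool} {q : B → Bool} {xs : List A} {ys : List B} →
  Unique xs → (∀ y → y ∈ ys) →
  (f : A → B) → (∀ x → T (p x) → T (q (f x))) →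
  (∀ x x′ → T (p x) → T (p x′) → f x ≡ f x′ → x ≡ x′) →
  (y₀ : B) → T (q y₀) → (∀ x → T (p x) → f x ≢ y₀) →
  countB p xs < countB q ys
countB-<-by-injection _≟_ {p} {q} {xs} {ys} xs! ys-complete f f-q f-injective y₀ qy₀ y₀∉img
  rewrite countB≡length-filter p xs | countB≡length-filter q ys
  = subst (_≤ length qys) (cong suc (length-map f pxs))
      (Unique∧⊆⇒length≤ _≟_ (y₀∉fpxs ∷ fpxs!) y₀∷fpxs⊆qys)
  where
  pxs = filter (T? ∘ p) xs
  qys = filter (T? ∘ q) ys
  p-of : ∀ {x} → x ∈ pxs → T (p x)
  p-of = proj₂ ∘ ∈-filter⁻ (T? ∘ p) {xs = xs}
  fpxs! : Unique (map f pxs)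
  fpxs! = map⁺-injectiveOn (Unique.filter⁺ (T? ∘ p) xs!) λ x∈ x′∈ → f-injective _ _ (p-of x∈) (p-of x′∈)
  y₀∉fpxs : All (y₀ ≢_) (map f pxs)
  y₀∉fpxs = All.tabulate λ y∈fpxs y₀≡y → let (x , x∈ , y≡fx) = ∈-map⁻ f y∈fpxs in
    y₀∉img x (p-of x∈) (sym (trans y₀≡y y≡fx))
  y₀∷fpxs⊆qys : (y₀ ∷ map f pxs) ⊆ qys
  y₀∷fpxs⊆qys (here refl) = ∈-filter⁺ (T? ∘ q) (ys-complete y₀) qy₀
  y₀∷fpxs⊆qys (there y∈fpxs) with ∈-map⁻ f y∈fpxs
  ... | x , x∈ , refl = ∈-filter⁺ (T? ∘ q) (ys-complete (f x)) (f-q x (p-of x∈))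

allB-intro : ∀ {A : Set} (p : A → Bool) xs → (∀ {x} → x ∈ xs → T (p x)) → T (allB p xs)
allB-intro p []       _ = _
allB-intro p (x ∷ xs) h = Equivalence.from T-∧ (h (here refl) , allB-intro p xs (h ∘ there))

allB-elim : ∀ {A : Set} (p : A → Bool) xs → T (allB p xs) → ∀ {x} → x ∈ xs → T (p x)
allB-elim p (y ∷ ys) h (here refl) = proj₁ (Equivalence.to (T-∧ {p y}) h)
allB-elim p (y ∷ ys) h (there x∈)  = allB-elim p ys (proj₂ (Equivalence.to (T-∧ {p y}) h)) x∈

concatMap-map≡cartesianProductWith : ∀ {A B C : Set} (f : A → B → C) xs ys →
  concatMap (λ x → map (f x) ys) xs ≡ cartesianProductWith f xs ys
concatMap-map≡cartesianProductWith f []       ys = refl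
concatMap-map≡cartesianProductWith f (x ∷ xs) ys =
  cong (map (f x) ys List.++_) (concatMap-map≡cartesianProductWith f xs ys)

allVecs-suc : ∀ {A : Set} (xs : List A) n →
              allVecs xs (suc n) ≡ cartesianProductWith _∷_ xs (allVecs xs n)
allVecs-suc xs n = concatMap-map≡cartesianProductWith _∷_ xs (allVecs xs n)

allVecs-complete : ∀ {A : Set} {xs : List A} → (∀ x → x ∈ xs) → ∀ n (v : Vec A n) → v ∈ allVecs xs n
allVecs-complete xs-complete zero    []       = here refl
allVecs-complete {xs = xs} xs-complete (suc n) (x ∷ v) rewrite allVecs-suc xs n =
  ∈-cartesianProductWith⁺ _∷_ (xs-complete x) (allVecs-complete xs-complete n v)

allVecs-unique : ∀ {A : Set} {xs : List A} → Unique xs → ∀ n → Unique (allVecs xs n)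
allVecs-unique xs! zero    = [] ∷ []
allVecs-unique {xs = xs} xs! (suc n) rewrite allVecs-suc xs n =
  Unique.cartesianProductWith⁺ _∷_ ∷-injective xs! (allVecs-unique xs! n)

tabulate-injective : ∀ {A : Set} {n} {f g : Fin n → A} → tabulate f ≡ tabulate g → ∀ i → f i ≡ g i
tabulate-injective {f = f} {g} eq i =
  trans (sym (lookup∘tabulate f i)) (trans (cong (λ v → lookup v i) eq) (lookup∘tabulate g i))

-- Subsets of Fin (n * m) cut into blocks

∣++∣ : ∀ {m n} (p : Subset m) (q : Subset n) → ∣ p ++ q ∣ ≡ ∣ p ∣ + ∣ q ∣
∣++∣ []          q = refl
∣++∣ (true ∷ p)  q = cong suc (∣++∣ p q)
∣++∣ (false ∷ p) q = ∣++∣ p q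

∣p∣≤1 : ∀ {n} {p : Subset n} → (∀ {x y} → x ∈ˢ p → y ∈ˢ p → x ≡ y) → ∣ p ∣ ≤ 1
∣p∣≤1 {n} {p} p-subsingleton with nonempty? p
... | yes (x , x∈p) = ≤-trans (p⊆q⇒∣p∣≤∣q∣ λ y∈p → subst (_∈ˢ ⁅ x ⁆) (p-subsingleton x∈p y∈p) (x∈⁅x⁆ x))
                              (subst (_≤ 1) (sym (∣⁅x⁆∣≡1 x)) ≤-refl)
... | no ¬nonempty  = subst (λ q → ∣ q ∣ ≤ 1) (sym (Empty-unique ¬nonempty)) (subst (_≤ 1) (sym (∣⊥∣≡0 n)) z≤n)

∣p∣≢0⇒Nonempty : ∀ {n} {p : Subset n} → ∣ p ∣ ≢ 0 → Nonempty p
∣p∣≢0⇒Nonempty {n} {p} ∣p∣≢0 with nonempty? p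
... | yes nonempty  = nonempty
... | no ¬nonempty  = contradiction (trans (cong ∣_∣ (Empty-unique ¬nonempty)) (∣⊥∣≡0 n)) ∣p∣≢0

+≡suc⇒≡1∧≡ : ∀ {a b n} → a ≤ 1 → b ≤ n → a + b ≡ suc n → a ≡ 1 × b ≡ n
+≡suc⇒≡1∧≡ {zero}        _        b≤n refl = contradiction b≤n 1+n≰n
+≡suc⇒≡1∧≡ {suc zero}    _        _   refl = refl , refl
+≡suc⇒≡1∧≡ {suc (suc a)} (s≤s ()) _   _

module _ {m : ℕ} where

  block : ∀ {n} → Subset (n * m) → Fin n → Subset m
  block S u = tabulate λ c → lookup S (combine u c)

  block-++-zero : ∀ {n} (p : Subset m) (S : Subset (n * m)) → block {suc n} (p ++ S) zero ≡ p
  block-++-zero p S = trans (tabulate-cong (lookup-++ˡ p S)) (tabulate∘lookup p)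

  block-++-suc : ∀ {n} (p : Subset m) (S : Subset (n * m)) u → block {suc n} (p ++ S) (suc u) ≡ block S u
  block-++-suc p S u = tabulate-cong λ c → lookup-++ʳ p S (combine u c)

  ∈-block⁻ : ∀ {n} (S : Subset (n * m)) {u : Fin n} {c : Fin m} → c ∈ˢ block S u → lookup S (combine u c) ≡ true
  ∈-block⁻ S {u} {c} c∈ = trans (sym (lookup∘tabulate (λ c → lookup S (combine u c)) c)) ([]=⇒lookup c∈)

  ∈-block⁺ : ∀ {n} (S : Subset (n * m)) {u : Fin n} {c : Fin m} → lookup S (combine u c) ≡ true → c ∈ˢ block S u
  ∈-block⁺ S {u} {c} c∈ = lookup⇒[]= c (block S u) (trans (lookup∘tabulate (λ c → lookup S (combine u c)) c) c∈)

  BlocksAtMostOne : ∀ {n} → Subset (n * m) → Set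
  BlocksAtMostOne {n} S = ∀ (u : Fin n) → ∣ block S u ∣ ≤ 1

  private module _ {n} (p : Subset m) (S : Subset (n * m)) (blocks≤1 : BlocksAtMostOne {suc n} (p ++ S)) where

    head-≤1 : ∣ p ∣ ≤ 1
    head-≤1 = subst (λ q → ∣ q ∣ ≤ 1) (block-++-zero {n} p S) (blocks≤1 zero)

    tail-≤1 : BlocksAtMostOne S
    tail-≤1 u = subst (λ q → ∣ q ∣ ≤ 1) (block-++-suc {n} p S u) (blocks≤1 (suc u))

  BlocksAtMostOne⇒∣S∣≤n : ∀ n (S : Subset (n * m)) → BlocksAtMostOne S → ∣ S ∣ ≤ n
  BlocksAtMostOne⇒∣S∣≤n zero    [] _ = z≤n
  BlocksAtMostOne⇒∣S∣≤n (suc n) S blocks≤1 with Vec.splitAt m S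
  ... | p , S′ , refl rewrite ∣++∣ p S′ =
    +-mono-≤ (head-≤1 {n} p S′ blocks≤1) (BlocksAtMostOne⇒∣S∣≤n n S′ (tail-≤1 {n} p S′ blocks≤1))

  BlocksAtMostOne∧∣S∣≡n⇒Nonempty : ∀ n (S : Subset (n * m)) → BlocksAtMostOne S → ∣ S ∣ ≡ n →
                                   ∀ (u : Fin n) → Nonempty (block S u)
  BlocksAtMostOne∧∣S∣≡n⇒Nonempty (suc n) S blocks≤1 ∣S∣≡ u with Vec.splitAt m S
  ... | p , S′ , refl
    with +≡suc⇒≡1∧≡ (head-≤1 {n} p S′ blocks≤1) (BlocksAtMostOne⇒∣S∣≤n n S′ (tail-≤1 {n} p S′ blocks≤1))
                    (trans (sym (∣++∣ p S′)) ∣S∣≡)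
  ... | ∣p∣≡1 , ∣S′∣≡n with u
  ...   | zero   = subst Nonempty (sym (block-++-zero {n} p S′))
                     (∣p∣≢0⇒Nonempty λ ∣p∣≡0 → contradiction (trans (sym ∣p∣≡1) ∣p∣≡0) λ ())
  ...   | suc u′ = subst Nonempty (sym (block-++-suc {n} p S′ u′))
                     (BlocksAtMostOne∧∣S∣≡n⇒Nonempty n S′ (tail-≤1 {n} p S′ blocks≤1) ∣S′∣≡n u′)

quotient-fibre-length : ∀ n m (u : Fin n) → length (filter (λ x → quotient m x ≟ u) (allFin (n * m))) ≡ m
quotient-fibre-length n m u = ≤-antisym
  (subst (length fibre ≤_) (length-tabulate (combine u)) (Unique∧⊆⇒length≤ _≟_ fibre! fibre⊆row))
  (subst (_≤ length fibre) (length-tabulate (combine u)) (Unique∧⊆⇒length≤ _≟_ row! row⊆fibre))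
  where
  fibre = filter (λ x → quotient m x ≟ u) (allFin (n * m))
  row   = List.tabulate (combine {n} {m} u)
  fibre! : Unique fibre
  fibre! = Unique.filter⁺ _ (Unique.allFin⁺ (n * m))
  row! : Unique row
  row! = Unique.tabulate⁺ λ {c} {c′} → combine-injectiveʳ u c u c′
  fibre⊆row : fibre ⊆ row
  fibre⊆row x∈ with ∈-filter⁻ (λ x → quotient m x ≟ u) {xs = allFin (n * m)} x∈
  ... | _ , refl = subst (_∈ row) (combine-remQuot {n} m _) (∈-tabulate⁺ _)
  row⊆fibre : row ⊆ fibre
  row⊆fibre c∈ with ∈-tabulate⁻ c∈
  ... | c , refl = ∈-filter⁺ _ (∈-allFin _) (cong proj₁ (remQuot-combine u c))

-- zero is a junk value; pick is only relied on for nonempty subsets.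
pick : ∀ {k} → Subset (suc k) → Fin (suc k)
pick p with nonempty? p
... | yes (c , _) = c
... | no _        = zero

pick-∈ : ∀ {k} {p : Subset (suc k)} → Nonempty p → pick p ∈ˢ p
pick-∈ {p = p} nonempty with nonempty? p
... | yes (_ , c∈p) = c∈p
... | no ¬nonempty  = contradiction nonempty ¬nonempty

-- Twisted covers

IsProperColouring : (G : Graph) {m : ℕ} → (Fin (size G) → Fin m) → Set
IsProperColouring G f = ∀ u v → T (edge G u v) → f u ≢ f v

does-≟-sym : ∀ {n} (u v : Fin n) → does (u ≟ v) ≡ does (v ≟ u)
does-≟-sym u v = does-⇔ (mk⇔ sym sym) (u ≟ v) (v ≟ u)

edge-sym : ∀ G u v → edge G u v ≡ edge G v u
edge-sym G u v rewrite does-≟-sym u v | ∨-comm (adj G u v) (adj G v u) = refl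

edge-irrefl : ∀ G u → ¬ T (edge G u u)
edge-irrefl G u rewrite dec-true (u ≟ u) refl = λ ()

properB-tabulate : ∀ G {m} (f : Fin (size G) → Fin m) → IsProperColouring G f → T (properB G (tabulate f))
properB-tabulate G f f-proper =
  allB-intro _ (allFin (size G)) λ {u} _ → allB-intro _ (allFin (size G)) λ {v} _ → ok u v
  where
  ok : ∀ u v → T (not (edge G u v ∧ does (lookup (tabulate f) u ≟ lookup (tabulate f) v)))
  ok u v rewrite lookup∘tabulate f u | lookup∘tabulate f v with edge G u v in uv
  ... | false = _
  ... | true  rewrite dec-false (f u ≟ f v) (f-proper u v (subst T (sym uv) _)) = _

module TwistedCover (G : Graph) (k : ℕ)
  (σ : Fin (size G) → Fin (size G) → Fin (suc k) → Fin (suc k))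
  (σ-inverse : ∀ u v c → σ v u (σ u v c) ≡ c) where

  -- The point combine u c is the copy of the colour c in the list of the vertex u.
  Point : Set
  Point = Fin (size G * suc k)

  layer : Point → Fin (size G)
  layer = quotient (suc k)

  colour : Point → Fin (suc k)
  colour = remainder {size G} (suc k)

  TwistedPair : Point → Point → Set
  TwistedPair x y = T (edge G (layer x) (layer y)) × colour y ≡ σ (layer x) (layer y) (colour x)

  coverAdj : Point → Point → Bool
  coverAdj x y = does (layer x ≟ layer y)
               ∨ (edge G (layer x) (layer y) ∧ does (colour y ≟ σ (layer x) (layer y) (colour x)))

  coverGraph : Graph
  coverGraph = record { size = size G * suc k ; adj = coverAdj }

  TwistedPair-sym : ∀ {x y} → TwistedPair x y → TwistedPair y x
  TwistedPair-sym {x} {y} (uv , y≡σx) =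
    subst T (edge-sym G (layer x) (layer y)) uv ,
    trans (sym (σ-inverse (layer x) (layer y) (colour x))) (cong (σ (layer y) (layer x)) (sym y≡σx))

  T-coverAdj : ∀ {x y} → layer x ≢ layer y → T (coverAdj x y) ⇔ TwistedPair x y
  T-coverAdj {x} {y} x≁y rewrite dec-false (layer x ≟ layer y) x≁y =
    mk⇔ (λ h → let (uv , eq) = Equivalence.to T-∧ h in uv , Equivalence.to (T-does (_ ≟ _)) eq)
        (λ (uv , eq) → Equivalence.from T-∧ (uv , Equivalence.from (T-does (_ ≟ _)) eq))

  edge-coverGraph : ∀ {x y} → layer x ≢ layer y → T (edge coverGraph x y) ⇔ TwistedPair x y
  edge-coverGraph {x} {y} x≁y rewrite dec-false (x ≟ y) (x≁y ∘ cong layer) = mk⇔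
    (λ h → [ Equivalence.to (T-coverAdj x≁y) , TwistedPair-sym ∘ Equivalence.to (T-coverAdj (x≁y ∘ sym)) ]′
             (Equivalence.to T-∨ h))
    (λ p → Equivalence.from T-∨ (inj₁ (Equivalence.from (T-coverAdj x≁y) p)))

  layer-combine : ∀ u c → layer (combine u c) ≡ u
  layer-combine u c = cong proj₁ (remQuot-combine {size G} {suc k} u c)

  colour-combine : ∀ u c → colour (combine u c) ≡ c
  colour-combine u c = cong proj₂ (remQuot-combine {size G} {suc k} u c)

  edge-combine : ∀ {u v c d} → u ≢ v →
                 T (edge coverGraph (combine u c) (combine v d)) ⇔ (T (edge G u v) × d ≡ σ u v c)
  edge-combine {u} {v} {c} {d} =
    aligned (layer-combine u c) (layer-combine v d) (colour-combine u c) (colour-combine v d)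
    where
    aligned : ∀ {x y u v c d} → layer x ≡ u → layer y ≡ v → colour x ≡ c → colour y ≡ d → u ≢ v →
              T (edge coverGraph x y) ⇔ (T (edge G u v) × d ≡ σ u v c)
    aligned refl refl refl refl = edge-coverGraph

  point-≡ : ∀ {x y} → layer x ≡ layer y → colour x ≡ colour y → x ≡ y
  point-≡ {x} {y} x∼y cx≡cy = trans (sym (combine-remQuot {size G} (suc k) x))
    (trans (cong₂ combine x∼y cx≡cy) (combine-remQuot {size G} (suc k) y))

  layers-complete : ∀ x y → layer x ≡ layer y → x ≢ y → T (edge coverGraph x y)
  layers-complete x y x∼y x≢y rewrite dec-false (x ≟ y) x≢y | dec-true (layer x ≟ layer y) x∼y = _

  between-layers-matching : ∀ x y z → layer x ≢ layer y → layer y ≡ layer z →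
                            T (edge coverGraph x y) → T (edge coverGraph x z) → y ≡ z
  between-layers-matching x y z x≁y y∼z xy xz = point-≡ y∼z (begin
    colour y                          ≡⟨ proj₂ (Equivalence.to (edge-coverGraph x≁y) xy) ⟩
    σ (layer x) (layer y) (colour x)  ≡⟨ cong (λ w → σ (layer x) w (colour x)) y∼z ⟩
    σ (layer x) (layer z) (colour x)  ≡⟨ sym (proj₂ (Equivalence.to (edge-coverGraph x≁z) xz)) ⟩
    colour z                          ∎)
    where
    open ≡-Reasoning
    x≁z : layer x ≢ layer z
    x≁z x∼z = x≁y (trans x∼z (sym y∼z))

  cover : Cover G (suc k)
  cover = record
    { H        = coverGraph
    ; part     = layer
    ; mfold    = quotient-fibre-length (size G) (suc k)
    ; clique   = λ x y x∼y x≢y → Equivalence.to T-≡ (layers-complete x y x∼y x≢y)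
    ; overEdge = λ x y x≁y xy →
        Equivalence.to T-≡ (proj₁ (Equivalence.to (edge-coverGraph x≁y) (Equivalence.from T-≡ xy)))
    ; matching = λ x y z x≁y y∼z xy xz →
        between-layers-matching x y z x≁y y∼z (Equivalence.from T-≡ xy) (Equivalence.from T-≡ xz)
    }

  colouringB : Subset (size G * suc k) → Bool
  colouringB S = does (∣ S ∣ ℕ.≟ size G) ∧ independentB coverGraph S

  IsTwistedColouring : (Fin (size G) → Fin (suc k)) → Set
  IsTwistedColouring g = ∀ u v → T (edge G u v) → g v ≢ σ u v (g u)

  graphOf : (Fin (size G) → Fin (suc k)) → Subset (size G * suc k)
  graphOf g = tabulate λ x → does (colour x ≟ g (layer x))

  graphOf-cong : ∀ {g g′} → (∀ u → g u ≡ g′ u) → graphOf g ≡ graphOf g′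
  graphOf-cong g≗g′ = tabulate-cong λ x → cong (λ c → does (colour x ≟ c)) (g≗g′ (layer x))

  colouringOf : Subset (size G * suc k) → Fin (size G) → Fin (suc k)
  colouringOf S u = pick (block S u)

  module _ {S : Subset (size G * suc k)} (S-colouring : T (colouringB S)) where

    private
      ∣S∣≡ : ∣ S ∣ ≡ size G
      ∣S∣≡ = Equivalence.to (T-does (∣ S ∣ ℕ.≟ size G)) (proj₁ (Equivalence.to T-∧ S-colouring))

      independent : ∀ x y → lookup S x ≡ true → lookup S y ≡ true → ¬ T (edge coverGraph x y)
      independent x y x∈S y∈S xy with allB-elim _ _ (allB-elim _ _ S-independent (∈-allFin x)) (∈-allFin y)
        where S-independent = proj₂ (Equivalence.to (T-∧ {does (∣ S ∣ ℕ.≟ size G)}) S-colouring)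
      ... | x-y-not-both rewrite x∈S | y∈S = subst T (Equivalence.to T-not-≡ x-y-not-both) xy

      block-subsingleton : ∀ u {c c′} → c ∈ˢ block S u → c′ ∈ˢ block S u → c ≡ c′
      block-subsingleton u {c} {c′} c∈ c′∈ = decidable-stable (c ≟ c′) λ c≢c′ →
        independent (combine u c) (combine u c′) (∈-block⁻ S {u} c∈) (∈-block⁻ S {u} c′∈)
          (layers-complete _ _ (trans (layer-combine u c) (sym (layer-combine u c′)))
                               (c≢c′ ∘ combine-injectiveʳ u c u c′))

      blocks-nonempty : ∀ u → Nonempty (block S u)
      blocks-nonempty = BlocksAtMostOne∧∣S∣≡n⇒Nonempty (size G) S (λ u → ∣p∣≤1 (block-subsingleton u)) ∣S∣≡

    colouringOf-∈ : ∀ u → lookup S (combine u (colouringOf S u)) ≡ true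
    colouringOf-∈ u = ∈-block⁻ S {u} (pick-∈ (blocks-nonempty u))

    colouringOf-twisted : IsTwistedColouring (colouringOf S)
    colouringOf-twisted u v uv gv≡σgu = independent _ _ (colouringOf-∈ u) (colouringOf-∈ v)
      (Equivalence.from (edge-combine (λ { refl → edge-irrefl G u uv })) (uv , gv≡σgu))

    S≡graphOf-colouringOf : S ≡ graphOf (colouringOf S)
    S≡graphOf-colouringOf = trans (sym (tabulate∘lookup S)) (tabulate-cong λ x →
      subst (λ x → lookup S x ≡ does (colour x ≟ colouringOf S (layer x)))
            (combine-remQuot {size G} (suc k) x) (on-layer (layer x) (colour x)))
      where
      on-layer : ∀ u c →
                 lookup S (combine u c) ≡ does (colour (combine u c) ≟ colouringOf S (layer (combine u c)))
      on-layer u c rewrite layer-combine u c | colour-combine u c with c ≟ colouringOf S u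
      ... | yes refl = colouringOf-∈ u
      ... | no c≢gu with lookup S (combine u c) in c∈
      ...   | true  = contradiction (block-subsingleton u (∈-block⁺ S {u} c∈) (pick-∈ (blocks-nonempty u))) c≢gu
      ...   | false = refl

  colouringOf-injective : ∀ {S S′} → T (colouringB S) → T (colouringB S′) →
                          (∀ u → colouringOf S u ≡ colouringOf S′ u) → S ≡ S′
  colouringOf-injective {S} {S′} S-col S′-col g≗g′ = begin
    S                           ≡⟨ S≡graphOf-colouringOf S-col ⟩
    graphOf (colouringOf S)     ≡⟨ graphOf-cong g≗g′ ⟩
    graphOf (colouringOf S′)    ≡⟨ sym (S≡graphOf-colouringOf S′-col) ⟩
    S′                          ∎
    where open ≡-Reasoning


-- Disjoint unions of cycles

module _ (G H : Graph) where

  edge-⊕-↑ˡ : ∀ x y → edge (G ⊕ H) (x ↑ˡ size H) (y ↑ˡ size H) ≡ edge G x y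
  edge-⊕-↑ˡ x y
    rewrite does-⇔ (mk⇔ (↑ˡ-injective (size H) x y) (cong (_↑ˡ size H))) ((x ↑ˡ size H) ≟ (y ↑ˡ size H)) (x ≟ y)
          | splitAt-↑ˡ (size G) x (size H) | splitAt-↑ˡ (size G) y (size H) = refl

  edge-⊕-↑ʳ : ∀ x y → edge (G ⊕ H) (size G ↑ʳ x) (size G ↑ʳ y) ≡ edge H x y
  edge-⊕-↑ʳ x y
    rewrite does-⇔ (mk⇔ (↑ʳ-injective (size G) x y) (cong (size G ↑ʳ_))) ((size G ↑ʳ x) ≟ (size G ↑ʳ y)) (x ≟ y)
          | splitAt-↑ʳ (size G) (size H) x | splitAt-↑ʳ (size G) (size H) y = refl

  edge-⊕-↑ˡ-↑ʳ : ∀ x y → edge (G ⊕ H) (x ↑ˡ size H) (size G ↑ʳ y) ≡ false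
  edge-⊕-↑ˡ-↑ʳ x y rewrite splitAt-↑ˡ (size G) x (size H) | splitAt-↑ʳ (size G) (size H) y = ∧-zeroʳ _

vertex : ∀ {n} (ks : Vec ℕ n) (i : Fin n) → Fin (lookup ks i) → Fin (size (cycles ks))
vertex (k ∷ ks) zero    j = j ↑ˡ size (cycles ks)
vertex (k ∷ ks) (suc i) j = k ↑ʳ vertex ks i j

position : ∀ {n} (ks : Vec ℕ n) → Fin (size (cycles ks)) → Σ (Fin n) (Fin ∘ lookup ks)
position (k ∷ ks) w with splitAt k w
... | inj₁ j  = zero , j
... | inj₂ w′ = let (i , j) = position ks w′ in suc i , j

position-vertex : ∀ {n} (ks : Vec ℕ n) i j → position ks (vertex ks i j) ≡ (i , j)
position-vertex (k ∷ ks) zero    j rewrite splitAt-↑ˡ k j (size (cycles ks)) = refl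
position-vertex (k ∷ ks) (suc i) j
  rewrite splitAt-↑ʳ k (size (cycles ks)) (vertex ks i j) | position-vertex ks i j = refl

vertex-position : ∀ {n} (ks : Vec ℕ n) w → uncurry (vertex ks) (position ks w) ≡ w
vertex-position (k ∷ ks) w with splitAt k w in eq
... | inj₁ j  = splitAt⁻¹-↑ˡ eq
... | inj₂ w′ = trans (cong (k ↑ʳ_) (vertex-position ks w′)) (splitAt⁻¹-↑ʳ eq)

edge-cycles-same : ∀ {n} (ks : Vec ℕ n) i j j′ →
                   edge (cycles ks) (vertex ks i j) (vertex ks i j′) ≡ edge (cycle (lookup ks i)) j j′
edge-cycles-same (k ∷ ks) zero    j j′ = edge-⊕-↑ˡ (cycle k) (cycles ks) j j′
edge-cycles-same (k ∷ ks) (suc i) j j′ =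
  trans (edge-⊕-↑ʳ (cycle k) (cycles ks) (vertex ks i j) (vertex ks i j′)) (edge-cycles-same ks i j j′)

edge-cycles-distinct : ∀ {n} (ks : Vec ℕ n) {i i′} j j′ → i ≢ i′ →
                       edge (cycles ks) (vertex ks i j) (vertex ks i′ j′) ≡ false
edge-cycles-distinct (k ∷ ks) {zero}  {zero}   j j′ i≢i′ = contradiction refl i≢i′
edge-cycles-distinct (k ∷ ks) {zero}  {suc i′} j j′ _    =
  edge-⊕-↑ˡ-↑ʳ (cycle k) (cycles ks) j (vertex ks i′ j′)
edge-cycles-distinct (k ∷ ks) {suc i} {zero}   j j′ _    =
  trans (edge-sym (cycle k ⊕ cycles ks) _ _) (edge-⊕-↑ˡ-↑ʳ (cycle k) (cycles ks) j′ (vertex ks i j))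
edge-cycles-distinct (k ∷ ks) {suc i} {suc i′} j j′ i≢i′ =
  trans (edge-⊕-↑ʳ (cycle k) (cycles ks) (vertex ks i j) (vertex ks i′ j′))
        (edge-cycles-distinct ks j j′ (i≢i′ ∘ cong suc))

edge-cycle-cast : ∀ {k k′} (e : k ≡ k′) (p q : Fin k) →
                  edge (cycle k′) (cast e p) (cast e q) ≡ edge (cycle k) p q
edge-cycle-cast refl p q rewrite cast-is-id refl p | cast-is-id refl q = refl

c₀ c₁ c₂ c₃ : Fin 4
c₀ = zero
c₁ = suc zero
c₂ = suc (suc zero)
c₃ = suc (suc (suc zero))

T-adj-cycle : ∀ {k} (i j : Fin k) → T (adj (cycle k) i j) →
              suc (toℕ i) ≡ toℕ j ⊎ (suc (toℕ i) ≡ k × toℕ j ≡ 0)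
T-adj-cycle {k} i j h with Equivalence.to T-∨ h
... | inj₁ succ = inj₁ (≡ᵇ⇒≡ _ _ succ)
... | inj₂ wrap = let (last , first) = Equivalence.to T-∧ wrap in inj₂ (≡ᵇ⇒≡ _ _ last , ≡ᵇ⇒≡ _ _ first)

alternating : ℕ → Fin 4
alternating zero          = c₁
alternating (suc zero)    = c₂
alternating (suc (suc n)) = alternating n

alternating-suc : ∀ n → alternating (suc n) ≢ alternating n
alternating-suc zero          ()
alternating-suc (suc zero)    ()
alternating-suc (suc (suc n)) = alternating-suc n

alternating≢c₀ : ∀ n → alternating n ≢ c₀
alternating≢c₀ zero          ()
alternating≢c₀ (suc zero)    ()
alternating≢c₀ (suc (suc n)) = alternating≢c₀ n

alternating≢c₃ : ∀ n → alternating n ≢ c₃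
alternating≢c₃ zero          ()
alternating≢c₃ (suc zero)    ()
alternating≢c₃ (suc (suc n)) = alternating≢c₃ n

cycleColouring : ∀ k → Fin k → Fin 4
cycleColouring k j = if does (suc (toℕ j) ℕ.≟ k) then c₃ else alternating (toℕ j)

cycleColouring-last : ∀ {k} (j : Fin k) → suc (toℕ j) ≡ k → cycleColouring k j ≡ c₃
cycleColouring-last {k} j last rewrite dec-true (suc (toℕ j) ℕ.≟ k) last = refl

cycleColouring-inner : ∀ {k} (j : Fin k) → suc (toℕ j) ≢ k → cycleColouring k j ≡ alternating (toℕ j)
cycleColouring-inner {k} j inner rewrite dec-false (suc (toℕ j) ℕ.≟ k) inner = refl

cycleColouring≢c₀ : ∀ k j → cycleColouring k j ≢ c₀
cycleColouring≢c₀ k j with suc (toℕ j) ℕ.≟ k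
... | yes last  rewrite cycleColouring-last j last   = λ ()
... | no  inner rewrite cycleColouring-inner j inner = alternating≢c₀ (toℕ j)

cycleColouring-adj : ∀ {k} → 2 ≤ k → ∀ i j → T (adj (cycle k) i j) → cycleColouring k i ≢ cycleColouring k j
cycleColouring-adj {k} 2≤k i j i→j with T-adj-cycle i j i→j
... | inj₁ succ rewrite cycleColouring-inner i (λ i-last → <-irrefl (trans (sym succ) i-last) (toℕ<n j))
  with suc (toℕ j) ℕ.≟ k
...   | yes last rewrite cycleColouring-last j last = alternating≢c₃ (toℕ i)
...   | no inner rewrite cycleColouring-inner j inner | sym succ = alternating-suc (toℕ i) ∘ sym
cycleColouring-adj {k} 2≤k i j i→j | inj₂ (last , first)
  rewrite cycleColouring-last i last
        | cycleColouring-inner j (λ j-last →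
            <-irrefl refl (subst (2 ≤_) (trans (sym j-last) (cong suc first)) 2≤k))
        | first = λ ()

cycleColouring-proper : ∀ {k} → 2 ≤ k → IsProperColouring (cycle k) (cycleColouring k)
cycleColouring-proper {k} 2≤k i j ij
  with Equivalence.to T-∨ (proj₂ (Equivalence.to (T-∧ {not (does (i ≟ j))}) ij))
... | inj₁ i→j = cycleColouring-adj 2≤k i j i→j
... | inj₂ j→i = cycleColouring-adj 2≤k j i j→i ∘ sym

-- Twisted colourings of the 4-cycle

module PairEncoding {V : Set} (proper big small reserved : V → Bool) (shift place : V → V)
  (shift-proper     : ∀ {s} → T (small s) → T (proper (shift s)))
  (shift-unreserved : ∀ {s} → T (small s) → ¬ T (reserved (shift s)))
  (shift-injective  : ∀ {s s′} → T (small s) → T (small s′) → shift s ≡ shift s′ → s ≡ s′)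
  (place-proper     : ∀ {b} → T (big b) → ¬ T (proper b) → T (proper (place b)))
  (place-reserved   : ∀ {b} → T (big b) → ¬ T (proper b) → T (reserved (place b)))
  (place-injective  : ∀ {b b′} → T (big b) → ¬ T (proper b) → T (big b′) → ¬ T (proper b′) →
                      place b ≡ place b′ → b ≡ b′)
  where

  encode : V → V → V × V
  encode b s = if proper b then (b , shift s) else (shift s , place b)

  module _ {b s} (big-b : T (big b)) (small-s : T (small s)) where

    encode-proper : T (proper (proj₁ (encode b s))) × T (proper (proj₂ (encode b s)))
    encode-proper with proper b in proper-b
    ... | true  = subst T (sym proper-b) _ , shift-proper small-s
    ... | false = shift-proper small-s , place-proper big-b (subst T proper-b)

    encode-off-diagonal : ∀ {r} → T (reserved r) → encode b s ≢ (r , r)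
    encode-off-diagonal {r} reserved-r eq with proper b
    ... | true  = shift-unreserved small-s (subst (T ∘ reserved) (sym (cong proj₂ eq)) reserved-r)
    ... | false = shift-unreserved small-s (subst (T ∘ reserved) (sym (cong proj₁ eq)) reserved-r)

  encode-injective : ∀ {b s b′ s′} → T (big b) → T (small s) → T (big b′) → T (small s′) →
                     encode b s ≡ encode b′ s′ → b ≡ b′ × s ≡ s′
  encode-injective {b} {s} {b′} {s′} big-b small-s big-b′ small-s′ eq
    with proper b in proper-b | proper b′ in proper-b′
  ... | true  | true  = cong proj₁ eq , shift-injective small-s small-s′ (cong proj₂ eq)
  ... | false | false = place-injective big-b (subst T proper-b) big-b′ (subst T proper-b′) (cong proj₂ eq)
                      , shift-injective small-s small-s′ (cong proj₁ eq)
  ... | true  | false = contradiction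
    (subst (T ∘ reserved) (sym (cong proj₂ eq)) (place-reserved big-b′ (subst T proper-b′)))
    (shift-unreserved small-s)
  ... | false | true  = contradiction
    (subst (T ∘ reserved) (cong proj₂ eq) (place-reserved big-b (subst T proper-b)))
    (shift-unreserved small-s′)

Colouring₄ : Set
Colouring₄ = Vec (Fin 4) 4

closing : ℕ → ℕ → Bool
closing p q = ((p ≡ᵇ 3) ∧ (q ≡ᵇ 0)) ∨ ((p ≡ᵇ 0) ∧ (q ≡ᵇ 3))

closing-sym : ∀ p q → closing p q ≡ closing q p
closing-sym p q rewrite ∧-comm (p ≡ᵇ 3) (q ≡ᵇ 0) | ∧-comm (p ≡ᵇ 0) (q ≡ᵇ 3) = ∨-comm ((q ≡ᵇ 0) ∧ (p ≡ᵇ 3)) _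

closingTwist : (Fin 4 → Fin 4) → ℕ → ℕ → Fin 4 → Fin 4
closingTwist π p q = if closing p q then π else id

closingTwist-sym : ∀ π p q → closingTwist π p q ≡ closingTwist π q p
closingTwist-sym π p q = cong (λ b → if b then π else id) (closing-sym p q)

closingTwist-involutive : ∀ {π} → (∀ c → π (π c) ≡ c) → ∀ p q c → closingTwist π p q (closingTwist π p q c) ≡ c
closingTwist-involutive π-involutive p q c with closing p q
... | true  = π-involutive c
... | false = refl

closingTwist-id : ∀ p q c → closingTwist id p q c ≡ c
closingTwist-id p q c with closing p q
... | true  = refl
... | false = refl

respectsB : (Fin 4 → Fin 4) → Colouring₄ → Fin 4 → Fin 4 → Bool
respectsB π c p q =
  not (edge (cycle 4) p q) ∨ not (does (lookup c q ≟ closingTwist π (toℕ p) (toℕ q) (lookup c p)))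

okAtB : (Fin 4 → Fin 4) → Fin 4 → Colouring₄ → Fin 4 → Bool
okAtB π x c p = not (does (lookup c p ≟ x)) ∧ allB (respectsB π c p) (allFin 4)

twistedB : (Fin 4 → Fin 4) → Fin 4 → Colouring₄ → Bool
twistedB π x c = allB (okAtB π x c) (allFin 4)

Twisted : (Fin 4 → Fin 4) → Fin 4 → Colouring₄ → Set
Twisted π x c = (∀ p → lookup c p ≢ x) ×
                (∀ p q → T (edge (cycle 4) p q) → lookup c q ≢ closingTwist π (toℕ p) (toℕ q) (lookup c p))

T-twistedB : ∀ {π x c} → T (twistedB π x c) ⇔ Twisted π x c
T-twistedB {π} {x} {c} = mk⇔ to from
  where
  at : T (twistedB π x c) → ∀ p → T (not (does (lookup c p ≟ x))) × T (allB (respectsB π c p) (allFin 4))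
  at h p = Equivalence.to T-∧ (allB-elim (okAtB π x c) (allFin 4) h (∈-allFin p))
  to : T (twistedB π x c) → Twisted π x c
  to h = (λ p → Equivalence.to (T-not-does (_ ≟ _)) (proj₁ (at h p)))
       , (λ p q pq → Equivalence.to (T-not-does (_ ≟ _)) (Equivalence.to T-implies
                       (allB-elim (respectsB π c p) (allFin 4) (proj₂ (at h p)) (∈-allFin q)) pq))
  from : Twisted π x c → T (twistedB π x c)
  from (avoids , respects) = allB-intro (okAtB π x c) (allFin 4) λ {p} _ → Equivalence.from T-∧
    ( Equivalence.from (T-not-does (_ ≟ _)) (avoids p)
    , allB-intro (respectsB π c p) (allFin 4) λ {q} _ →
        Equivalence.from T-implies λ pq → Equivalence.from (T-not-does (_ ≟ _)) (respects p q pq))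

πa πb : Fin 4 → Fin 4
πa = transpose c₂ c₃
πb = transpose c₀ c₁

πa-involutive : ∀ c → πa (πa c) ≡ c
πa-involutive zero                   = refl
πa-involutive (suc zero)             = refl
πa-involutive (suc (suc zero))       = refl
πa-involutive (suc (suc (suc zero))) = refl

πb-involutive : ∀ c → πb (πb c) ≡ c
πb-involutive zero                   = refl
πb-involutive (suc zero)             = refl
πb-involutive (suc (suc zero))       = refl
πb-involutive (suc (suc (suc zero))) = refl

properB₄ : Fin 4 → Colouring₄ → Bool
properB₄ = twistedB id

πa-fixes : Fin 4 → Bool
πa-fixes x = does (πa x ≟ x)

bigB smallB extraB : Fin 4 → Colouring₄ → Bool
bigB   x = if πa-fixes x then twistedB πb x else twistedB πa x
smallB x = if πa-fixes x then twistedB πa x else twistedB πb x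
extraB x c = bigB x c ∧ not (properB₄ x c)

colourings₄ : List Colouring₄
colourings₄ = allVecs (allFin 4) 4

_==_ : Colouring₄ → Colouring₄ → Bool
c == c′ = does (≡-dec _≟_ c c′)

indexIn : List Colouring₄ → Colouring₄ → ℕ
indexIn []        c = 0
indexIn (c′ ∷ cs) c = if c == c′ then 0 else suc (indexIn cs c)

entryOf : List Colouring₄ → ℕ → Colouring₄
entryOf []       _       = c₀ ∷ c₀ ∷ c₀ ∷ c₀ ∷ []
entryOf (c ∷ cs) zero    = c
entryOf (c ∷ cs) (suc i) = entryOf cs i

-- shift and place are β and d of the proof idea: the i-th small colouring goes to the i-th proper one,
-- the i-th extra one to the proper one at position |smalls| + i, which is what makes it reserved.
module Tables (x : Fin 4) (smalls propers extras : List Colouring₄) where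

  shift unshift place unplace : Colouring₄ → Colouring₄
  shift   = entryOf propers ∘ indexIn smalls
  unshift = entryOf smalls ∘ indexIn propers
  place   = entryOf propers ∘ (length smalls +_) ∘ indexIn extras
  unplace = entryOf extras ∘ (_∸ length smalls) ∘ indexIn propers

  reservedB : Colouring₄ → Bool
  reservedB p = length smalls ≤ᵇ indexIn propers p

  entryOK : Colouring₄ → Bool
  entryOK c = (not (smallB x c) ∨ (properB₄ x (shift c) ∧ not (reservedB (shift c)) ∧ (unshift (shift c) == c)))
            ∧ (not (extraB x c) ∨ (properB₄ x (place c) ∧ reservedB (place c) ∧ (unplace (place c) == c)))

  tablesOK : Bool
  tablesOK = allB entryOK colourings₄

-- Opaque, so that type checking never unfolds these enumerations except in the two finite checks.
opaque
  smalls propers extras : Fin 4 → List Colouring₄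
  smalls  x = filterᵇ (smallB x) colourings₄
  propers x = filterᵇ (properB₄ x) colourings₄
  extras  x = filterᵇ (extraB x) colourings₄

module TablesFor (x : Fin 4) = Tables x (smalls x) (propers x) (extras x)

opaque
  unfolding smalls propers extras

  tables-ok : T (allB TablesFor.tablesOK (allFin 4))
  tables-ok = _

module Merge (x : Fin 4) where
  open TablesFor x public using (reservedB)
  open TablesFor x using (shift; unshift; place; unplace; entryOK)

  private
    entry-ok : ∀ c → T (entryOK c)
    entry-ok c = allB-elim entryOK colourings₄
      (allB-elim TablesFor.tablesOK (allFin 4) tables-ok (∈-allFin x))
      (allVecs-complete ∈-allFin 4 c)

    T-== : ∀ {c c′} → T (c == c′) → c ≡ c′
    T-== = Equivalence.to (T-does (≡-dec _≟_ _ _))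

    shift-entry : ∀ {s} → T (smallB x s) →
                  T (properB₄ x (shift s)) × ¬ T (reservedB (shift s)) × unshift (shift s) ≡ s
    shift-entry {s} small-s =
      let (proper , rest) =
            Equivalence.to T-∧ (Equivalence.to T-implies (proj₁ (Equivalence.to T-∧ (entry-ok s))) small-s)
          (unreserved , inverse) = Equivalence.to T-∧ rest
      in proper , Equivalence.to T-not unreserved , T-== inverse

    place-entry : ∀ {b} → T (bigB x b) → ¬ T (properB₄ x b) →
                  T (properB₄ x (place b)) × T (reservedB (place b)) × unplace (place b) ≡ b
    place-entry {b} big-b improper-b =
      let extra-b = Equivalence.from T-∧ (big-b , Equivalence.from T-not improper-b)
          (proper , rest) =
            Equivalence.to T-∧ (Equivalence.to T-implies (proj₂ (Equivalence.to T-∧ (entry-ok b))) extra-b)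
          (reserved , inverse) = Equivalence.to T-∧ rest
      in proper , reserved , T-== inverse

  open PairEncoding (properB₄ x) (bigB x) (smallB x) reservedB shift place
    (proj₁ ∘ shift-entry) (proj₁ ∘ proj₂ ∘ shift-entry)
    (λ small-s small-s′ eq → trans (sym (proj₂ (proj₂ (shift-entry small-s))))
                               (trans (cong unshift eq) (proj₂ (proj₂ (shift-entry small-s′)))))
    (λ big-b improper-b → proj₁ (place-entry big-b improper-b))
    (λ big-b improper-b → proj₁ (proj₂ (place-entry big-b improper-b)))
    (λ big-b improper-b big-b′ improper-b′ eq → trans (sym (proj₂ (proj₂ (place-entry big-b improper-b))))
                               (trans (cong unplace eq) (proj₂ (proj₂ (place-entry big-b′ improper-b′)))))

  merge : Colouring₄ → Colouring₄ → Colouring₄ × Colouring₄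
  merge ca cb = if πa-fixes x then encode cb ca else encode ca cb

  private
    big-if-fixed : ∀ {c} → πa-fixes x ≡ true → T (twistedB πb x c) → T (bigB x c)
    big-if-fixed {c} fixes = subst (λ f → T ((if f then twistedB πb x else twistedB πa x) c)) (sym fixes)
    small-if-fixed : ∀ {c} → πa-fixes x ≡ true → T (twistedB πa x c) → T (smallB x c)
    small-if-fixed {c} fixes = subst (λ f → T ((if f then twistedB πa x else twistedB πb x) c)) (sym fixes)
    big-if-moved : ∀ {c} → πa-fixes x ≡ false → T (twistedB πa x c) → T (bigB x c)
    big-if-moved {c} moves = subst (λ f → T ((if f then twistedB πb x else twistedB πa x) c)) (sym moves)
    small-if-moved : ∀ {c} → πa-fixes x ≡ false → T (twistedB πb x c) → T (smallB x c)
    small-if-moved {c} moves = subst (λ f → T ((if f then twistedB πa x else twistedB πb x) c)) (sym moves)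

  module _ {ca cb} (ta : T (twistedB πa x ca)) (tb : T (twistedB πb x cb)) where

    merge-proper : T (properB₄ x (proj₁ (merge ca cb))) × T (properB₄ x (proj₂ (merge ca cb)))
    merge-proper = if-elim (λ pr → T (properB₄ x (proj₁ pr)) × T (properB₄ x (proj₂ pr))) (πa-fixes x)
      (λ fixes → encode-proper {cb} {ca} (big-if-fixed fixes tb) (small-if-fixed fixes ta))
      (λ moves → encode-proper {ca} {cb} (big-if-moved moves ta) (small-if-moved moves tb))

    merge-off-diagonal : ∀ {r} → T (reservedB r) → merge ca cb ≢ (r , r)
    merge-off-diagonal {r} reserved-r = if-elim (λ pr → pr ≢ (r , r)) (πa-fixes x)
      (λ fixes → encode-off-diagonal {cb} {ca} (big-if-fixed fixes tb) (small-if-fixed fixes ta) {r} reserved-r)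
      (λ moves → encode-off-diagonal {ca} {cb} (big-if-moved moves ta) (small-if-moved moves tb) {r} reserved-r)

  merge-injective : ∀ {ca cb ca′ cb′} → T (twistedB πa x ca) → T (twistedB πb x cb) →
                    T (twistedB πa x ca′) → T (twistedB πb x cb′) →
                    merge ca cb ≡ merge ca′ cb′ → ca ≡ ca′ × cb ≡ cb′
  merge-injective {ca} {cb} {ca′} {cb′} ta tb ta′ tb′ eq = bool-cases (πa-fixes x)
    (λ fixes → swap (encode-injective (big-if-fixed fixes tb) (small-if-fixed fixes ta)
                                      (big-if-fixed fixes tb′) (small-if-fixed fixes ta′)
                                      (unfold-merge fixes eq)))
    (λ moves → encode-injective (big-if-moved moves ta) (small-if-moved moves tb)
                                (big-if-moved moves ta′) (small-if-moved moves tb′)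
                                (unfold-merge moves eq))
    where
    unfold-merge : ∀ {b} → πa-fixes x ≡ b → merge ca cb ≡ merge ca′ cb′ →
                   (if b then encode cb ca else encode ca cb) ≡ (if b then encode cb′ ca′ else encode ca′ cb′)
    unfold-merge refl eq = eq

opaque
  unfolding smalls propers extras

  reserved-proper : Σ Colouring₄ λ r → T (properB₄ c₀ r) × T (Merge.reservedB c₀ r)
  reserved-proper = TablesFor.place c₀ (c₁ ∷ c₂ ∷ c₃ ∷ c₁ ∷ []) , _ , _

-- The cover of K₁ ∨ G

module Construction {n} (ks : Vec ℕ n) (ks≥2 : ∀ i → 2 ≤ lookup ks i) (a b : Fin n) (a≢b : a ≢ b)
  (ka : lookup ks a ≡ 4) (kb : lookup ks b ≡ 4) where

  G M : Graph
  G = cycles ks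
  M = K1∨ G

  Position : Set
  Position = Σ (Fin n) (Fin ∘ lookup ks)

  -- Positions enter closingTwist through toℕ, since a position on the i-th cycle has type Fin (lookup ks i).
  twistAt : Position → Position → Fin 4 → Fin 4
  twistAt (i , p) (i′ , q) =
    if does (i ≟ a) ∧ does (i′ ≟ a) then closingTwist πa (toℕ p) (toℕ q)
    else if does (i ≟ b) ∧ does (i′ ≟ b) then closingTwist πb (toℕ p) (toℕ q)
    else id

  twistAt-sym : ∀ s t → twistAt s t ≡ twistAt t s
  twistAt-sym (i , p) (i′ , q)
    rewrite ∧-comm (does (i ≟ a)) (does (i′ ≟ a)) | ∧-comm (does (i ≟ b)) (does (i′ ≟ b))
          | closingTwist-sym πa (toℕ p) (toℕ q) | closingTwist-sym πb (toℕ p) (toℕ q) = refl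

  twistAt-involutive : ∀ s t c → twistAt s t (twistAt s t c) ≡ c
  twistAt-involutive (i , p) (i′ , q) c with does (i ≟ a) ∧ does (i′ ≟ a)
  ... | true  = closingTwist-involutive πa-involutive (toℕ p) (toℕ q) c
  ... | false with does (i ≟ b) ∧ does (i′ ≟ b)
  ...   | true  = closingTwist-involutive πb-involutive (toℕ p) (toℕ q) c
  ...   | false = refl

  σ : Fin (size M) → Fin (size M) → Fin 4 → Fin 4
  σ (suc w) (suc w′) = twistAt (position ks w) (position ks w′)
  σ _       _        = id

  σ-inverse : ∀ u v c → σ v u (σ u v c) ≡ c
  σ-inverse zero    zero     c = refl
  σ-inverse zero    (suc w′) c = refl
  σ-inverse (suc w) zero     c = refl
  σ-inverse (suc w) (suc w′) c rewrite twistAt-sym (position ks w′) (position ks w) =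
    twistAt-involutive (position ks w) (position ks w′) c

  open TwistedCover M 3 σ σ-inverse public

  onA onB : Fin 4 → Fin (size G)
  onA p = vertex ks a (cast (sym ka) p)
  onB p = vertex ks b (cast (sym kb) p)

  edge-onA : ∀ p q → edge G (onA p) (onA q) ≡ edge (cycle 4) p q
  edge-onA p q = trans (edge-cycles-same ks a _ _) (edge-cycle-cast (sym ka) p q)

  edge-onB : ∀ p q → edge G (onB p) (onB q) ≡ edge (cycle 4) p q
  edge-onB p q = trans (edge-cycles-same ks b _ _) (edge-cycle-cast (sym kb) p q)

  σ-onA : ∀ p q → σ (suc (onA p)) (suc (onA q)) ≡ closingTwist πa (toℕ p) (toℕ q)
  σ-onA p q rewrite position-vertex ks a (cast (sym ka) p) | position-vertex ks a (cast (sym ka) q)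
                  | dec-true (a ≟ a) refl | toℕ-cast (sym ka) p | toℕ-cast (sym ka) q = refl

  σ-onB : ∀ p q → σ (suc (onB p)) (suc (onB q)) ≡ closingTwist πb (toℕ p) (toℕ q)
  σ-onB p q rewrite position-vertex ks b (cast (sym kb) p) | position-vertex ks b (cast (sym kb) q)
                  | dec-false (b ≟ a) (a≢b ∘ sym) | dec-true (b ≟ b) refl
                  | toℕ-cast (sym kb) p | toℕ-cast (sym kb) q = refl

  σ-elsewhere : ∀ {i} p q → i ≢ a → i ≢ b → σ (suc (vertex ks i p)) (suc (vertex ks i q)) ≡ id
  σ-elsewhere {i} p q i≢a i≢b rewrite position-vertex ks i p | position-vertex ks i q
                                    | dec-false (i ≟ a) i≢a | dec-false (i ≟ b) i≢b = refl

  restrict : (Fin 4 → Fin (size G)) → (Fin (size M) → Fin 4) → Colouring₄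
  restrict on g = tabulate (g ∘ suc ∘ on)

  restrictions : (Fin (size M) → Fin 4) → Colouring₄ × Colouring₄
  restrictions g = restrict onA g , restrict onB g

  restrictions-cong : ∀ {g g′} → (∀ u → g u ≡ g′ u) → restrictions g ≡ restrictions g′
  restrictions-cong g≗g′ = cong₂ _,_ (tabulate-cong (g≗g′ ∘ suc ∘ onA)) (tabulate-cong (g≗g′ ∘ suc ∘ onB))

  lookup-restrictA : ∀ g p → lookup (restrict onA g) (cast ka p) ≡ g (suc (vertex ks a p))
  lookup-restrictA g p = trans (lookup∘tabulate (g ∘ suc ∘ onA) (cast ka p))
                               (cong (λ p′ → g (suc (vertex ks a p′))) (cast-involutive (sym ka) ka p))

  lookup-restrictB : ∀ g p → lookup (restrict onB g) (cast kb p) ≡ g (suc (vertex ks b p))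
  lookup-restrictB g p = trans (lookup∘tabulate (g ∘ suc ∘ onB) (cast kb p))
                               (cong (λ p′ → g (suc (vertex ks b p′))) (cast-involutive (sym kb) kb p))

  module _ {g : Fin (size M) → Fin 4} (g-twisted : IsTwistedColouring g) where

    twisted-avoids-apex : ∀ w → g (suc w) ≢ g zero
    twisted-avoids-apex w = g-twisted zero (suc w) _

    twisted-elsewhere : ∀ {i} p q → i ≢ a → i ≢ b → T (edge (cycle (lookup ks i)) p q) →
                        g (suc (vertex ks i p)) ≢ g (suc (vertex ks i q))
    twisted-elsewhere {i} p q i≢a i≢b pq eq = g-twisted (suc (vertex ks i p)) (suc (vertex ks i q))
      (subst T (sym (edge-cycles-same ks i p q)) pq)
      (trans (sym eq) (sym (cong (λ f → f (g (suc (vertex ks i p)))) (σ-elsewhere p q i≢a i≢b))))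

    restrict-twisted : ∀ on π → (∀ p q → edge G (on p) (on q) ≡ edge (cycle 4) p q) →
                       (∀ p q → σ (suc (on p)) (suc (on q)) ≡ closingTwist π (toℕ p) (toℕ q)) →
                       T (twistedB π (g zero) (restrict on g))
    restrict-twisted on π edge-on σ-on =
      Equivalence.from (T-twistedB {π} {g zero} {restrict on g}) (avoids , respects)
      where
      avoids : ∀ p → lookup (restrict on g) p ≢ g zero
      avoids p rewrite lookup∘tabulate (g ∘ suc ∘ on) p = twisted-avoids-apex (on p)
      respects : ∀ p q → T (edge (cycle 4) p q) →
                 lookup (restrict on g) q ≢ closingTwist π (toℕ p) (toℕ q) (lookup (restrict on g) p)
      respects p q pq
        rewrite lookup∘tabulate (g ∘ suc ∘ on) p | lookup∘tabulate (g ∘ suc ∘ on) q | sym (σ-on p q) =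
        g-twisted (suc (on p)) (suc (on q)) (subst T (sym (edge-on p q)) pq)

    restrictA-twisted : T (twistedB πa (g zero) (restrict onA g))
    restrictA-twisted = restrict-twisted onA πa edge-onA σ-onA

    restrictB-twisted : T (twistedB πb (g zero) (restrict onB g))
    restrictB-twisted = restrict-twisted onB πb edge-onB σ-onB

  cycle-cases : ∀ i → i ≡ a ⊎ i ≡ b ⊎ (i ≢ a × i ≢ b)
  cycle-cases i with i ≟ a | i ≟ b
  ... | yes i≡a | _       = inj₁ i≡a
  ... | no _    | yes i≡b = inj₂ (inj₁ i≡b)
  ... | no i≢a  | no i≢b  = inj₂ (inj₂ (i≢a , i≢b))

  overlay : Colouring₄ × Colouring₄ → (Fin (size G) → Fin 4) → ∀ i → Fin (lookup ks i) → Fin 4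
  overlay (pa , pb) r i p with i ≟ a | i ≟ b
  ... | yes refl | _        = lookup pa (cast ka p)
  ... | no _     | yes refl = lookup pb (cast kb p)
  ... | no _     | no _     = r (vertex ks i p)

  overlay-a : ∀ pa pb r p → overlay (pa , pb) r a p ≡ lookup pa (cast ka p)
  overlay-a pa pb r p with a ≟ a
  ... | yes refl = refl
  ... | no a≢a   = contradiction refl a≢a

  overlay-b : ∀ pa pb r p → overlay (pa , pb) r b p ≡ lookup pb (cast kb p)
  overlay-b pa pb r p with b ≟ a | b ≟ b
  ... | yes b≡a | _        = contradiction (sym b≡a) a≢b
  ... | no _    | yes refl = refl
  ... | no _    | no b≢b   = contradiction refl b≢b

  overlay-elsewhere : ∀ pab r {i} p → i ≢ a → i ≢ b → overlay pab r i p ≡ r (vertex ks i p)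
  overlay-elsewhere pab r {i} p i≢a i≢b with i ≟ a | i ≟ b
  ... | yes i≡a | _       = contradiction i≡a i≢a
  ... | no _    | yes i≡b = contradiction i≡b i≢b
  ... | no _    | no _    = refl

  rebuild : Fin 4 → Colouring₄ × Colouring₄ → (Fin (size G) → Fin 4) → Fin (size M) → Fin 4
  rebuild x _   _ zero    = x
  rebuild x pab r (suc w) = uncurry (overlay pab r) (position ks w)

  rebuild-vertex : ∀ x pab r i p → rebuild x pab r (suc (vertex ks i p)) ≡ overlay pab r i p
  rebuild-vertex x pab r i p = cong (uncurry (overlay pab r)) (position-vertex ks i p)

  restrictions-rebuild : ∀ x pab r → restrictions (rebuild x pab r) ≡ pab
  restrictions-rebuild x (pa , pb) r = cong₂ _,_
    (trans (tabulate-cong λ p → trans (rebuild-vertex x (pa , pb) r a _) (trans (overlay-a pa pb r _)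
                                  (cong (lookup pa) (cast-involutive ka (sym ka) p))))
           (tabulate∘lookup pa))
    (trans (tabulate-cong λ p → trans (rebuild-vertex x (pa , pb) r b _) (trans (overlay-b pa pb r _)
                                  (cong (lookup pb) (cast-involutive kb (sym kb) p))))
           (tabulate∘lookup pb))

  module _ {x : Fin 4} {pa pb : Colouring₄} {r : Fin (size G) → Fin 4}
           (pa-proper : T (properB₄ x pa)) (pb-proper : T (properB₄ x pb))
           (r-avoids : ∀ {i} p → i ≢ a → i ≢ b → r (vertex ks i p) ≢ x)
           (r-proper : ∀ {i} p q → i ≢ a → i ≢ b → T (edge (cycle (lookup ks i)) p q) →
                       r (vertex ks i p) ≢ r (vertex ks i q)) where

    private
      properB₄-avoids : ∀ c → T (properB₄ x c) → ∀ p → lookup c p ≢ x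
      properB₄-avoids c c-proper = proj₁ (Equivalence.to (T-twistedB {id} {x} {c}) c-proper)

      properB₄-proper : ∀ c → T (properB₄ x c) → ∀ p q → T (edge (cycle 4) p q) → lookup c p ≢ lookup c q
      properB₄-proper c c-proper p q pq eq = proj₂ (Equivalence.to (T-twistedB {id} {x} {c}) c-proper) p q pq
        (trans (sym eq) (sym (closingTwist-id (toℕ p) (toℕ q) (lookup c p))))

      overlay-avoids : ∀ i p → overlay (pa , pb) r i p ≢ x
      overlay-avoids i p with cycle-cases i
      ... | inj₁ refl        rewrite overlay-a pa pb r p = properB₄-avoids pa pa-proper (cast ka p)
      ... | inj₂ (inj₁ refl) rewrite overlay-b pa pb r p = properB₄-avoids pb pb-proper (cast kb p)
      ... | inj₂ (inj₂ (i≢a , i≢b)) rewrite overlay-elsewhere (pa , pb) r p i≢a i≢b = r-avoids p i≢a i≢b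

      overlay-proper : ∀ i p q → T (edge (cycle (lookup ks i)) p q) →
                       overlay (pa , pb) r i p ≢ overlay (pa , pb) r i q
      overlay-proper i p q pq with cycle-cases i
      ... | inj₁ refl rewrite overlay-a pa pb r p | overlay-a pa pb r q =
        properB₄-proper pa pa-proper (cast ka p) (cast ka q) (subst T (sym (edge-cycle-cast ka p q)) pq)
      ... | inj₂ (inj₁ refl) rewrite overlay-b pa pb r p | overlay-b pa pb r q =
        properB₄-proper pb pb-proper (cast kb p) (cast kb q) (subst T (sym (edge-cycle-cast kb p q)) pq)
      ... | inj₂ (inj₂ (i≢a , i≢b))
        rewrite overlay-elsewhere (pa , pb) r p i≢a i≢b | overlay-elsewhere (pa , pb) r q i≢a i≢b =
        r-proper p q i≢a i≢b pq

      rebuild-avoids : ∀ w → rebuild x (pa , pb) r (suc w) ≢ x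
      rebuild-avoids w = overlay-avoids (proj₁ (position ks w)) (proj₂ (position ks w))

      rebuild-proper-on-G : ∀ w w′ → T (edge G w w′) →
                            rebuild x (pa , pb) r (suc w) ≢ rebuild x (pa , pb) r (suc w′)
      rebuild-proper-on-G w w′ ww′
        with position ks w | position ks w′ | vertex-position ks w | vertex-position ks w′
      ... | i , p | i′ , q | refl | refl with i ≟ i′
      ...   | yes refl = overlay-proper i p q (subst T (edge-cycles-same ks i p q) ww′)
      ...   | no i≢i′  = contradiction (subst T (edge-cycles-distinct ks p q i≢i′) ww′) λ ()

    rebuild-proper : IsProperColouring M (rebuild x (pa , pb) r)
    rebuild-proper zero    zero     zz   = contradiction zz (edge-irrefl M zero)
    rebuild-proper zero    (suc w)  _    = rebuild-avoids w ∘ sym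
    rebuild-proper (suc w) zero     _    = rebuild-avoids w
    rebuild-proper (suc w) (suc w′) ww′  = rebuild-proper-on-G w w′ ww′

  merge : Fin 4 → Colouring₄ × Colouring₄ → Colouring₄ × Colouring₄
  merge x = uncurry (Merge.merge x)

  merged : (Fin (size M) → Fin 4) → Colouring₄ × Colouring₄
  merged g = merge (g zero) (restrictions g)

  straighten : (Fin (size M) → Fin 4) → Fin (size M) → Fin 4
  straighten g = rebuild (g zero) (merged g) (g ∘ suc)

  straighten-proper : ∀ {g} → IsTwistedColouring g → IsProperColouring M (straighten g)
  straighten-proper {g} g-twisted = rebuild-proper (proj₁ merged-proper) (proj₂ merged-proper)
    (λ p _ _ → twisted-avoids-apex g-twisted (vertex ks _ p)) (twisted-elsewhere g-twisted)
    where
    merged-proper = Merge.merge-proper (g zero) (restrictA-twisted g-twisted) (restrictB-twisted g-twisted)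

  straighten-elsewhere : ∀ g {i} p → i ≢ a → i ≢ b →
                         straighten g (suc (vertex ks i p)) ≡ g (suc (vertex ks i p))
  straighten-elsewhere g p i≢a i≢b =
    trans (rebuild-vertex (g zero) (merged g) (g ∘ suc) _ p) (overlay-elsewhere (merged g) (g ∘ suc) p i≢a i≢b)

  colouring-ext : ∀ {g g′ : Fin (size M) → Fin 4} → g zero ≡ g′ zero → restrictions g ≡ restrictions g′ →
                  (∀ {i} p → i ≢ a → i ≢ b → g (suc (vertex ks i p)) ≡ g′ (suc (vertex ks i p))) →
                  ∀ u → g u ≡ g′ u
  colouring-ext apex _ _ zero = apex
  colouring-ext {g} {g′} _ restrictions≡ elsewhere (suc w) with position ks w | vertex-position ks w
  ... | i , p | refl with cycle-cases i
  ...   | inj₁ refl = begin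
    g (suc (vertex ks a p))          ≡⟨ lookup-restrictA g p ⟨
    lookup (restrict onA g) (cast ka p)   ≡⟨ cong (λ c → lookup (proj₁ c) (cast ka p)) restrictions≡ ⟩
    lookup (restrict onA g′) (cast ka p)  ≡⟨ lookup-restrictA g′ p ⟩
    g′ (suc (vertex ks a p))          ∎
    where open ≡-Reasoning
  ...   | inj₂ (inj₁ refl) = begin
    g (suc (vertex ks b p))          ≡⟨ lookup-restrictB g p ⟨
    lookup (restrict onB g) (cast kb p)   ≡⟨ cong (λ c → lookup (proj₂ c) (cast kb p)) restrictions≡ ⟩
    lookup (restrict onB g′) (cast kb p)  ≡⟨ lookup-restrictB g′ p ⟩
    g′ (suc (vertex ks b p))          ∎
    where open ≡-Reasoning
  ...   | inj₂ (inj₂ (i≢a , i≢b)) = elsewhere p i≢a i≢b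

  straighten-injective : ∀ {g g′} → IsTwistedColouring g → IsTwistedColouring g′ →
                         (∀ u → straighten g u ≡ straighten g′ u) → ∀ u → g u ≡ g′ u
  straighten-injective {g} {g′} g-twisted g′-twisted st≗st′ = colouring-ext apex
    (uncurry (cong₂ _,_) (Merge.merge-injective (g zero)
      (restrictA-twisted g-twisted) (restrictB-twisted g-twisted)
      (subst (λ x → T (twistedB πa x (restrict onA g′))) (sym apex) (restrictA-twisted g′-twisted))
      (subst (λ x → T (twistedB πb x (restrict onB g′))) (sym apex) (restrictB-twisted g′-twisted))
      merged≡))
    (λ p i≢a i≢b → trans (sym (straighten-elsewhere g p i≢a i≢b))
                         (trans (st≗st′ _) (straighten-elsewhere g′ p i≢a i≢b)))
    where
    apex : g zero ≡ g′ zero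
    apex = st≗st′ zero
    merged≡ : merged g ≡ merge (g zero) (restrictions g′)
    merged≡ = begin
      merged g                                       ≡⟨ restrictions-rebuild (g zero) (merged g) (g ∘ suc) ⟨
      restrictions (straighten g)                    ≡⟨ restrictions-cong st≗st′ ⟩
      restrictions (straighten g′)                   ≡⟨ restrictions-rebuild (g′ zero) (merged g′) (g′ ∘ suc) ⟩
      merged g′                                      ≡⟨ cong (λ x → merge x (restrictions g′)) apex ⟨
      merge (g zero) (restrictions g′)               ∎
      where open ≡-Reasoning

  missedColouring : Fin (size M) → Fin 4
  missedColouring = rebuild c₀ (r , r) (uncurry (cycleColouring ∘ lookup ks) ∘ position ks)
    where r = proj₁ reserved-proper

  missedColouring-proper : IsProperColouring M missedColouring
  missedColouring-proper = rebuild-proper r-proper r-proper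
    (λ {i} p _ _ → subst (_≢ c₀) (cycleColouring-vertex i p) (cycleColouring≢c₀ (lookup ks i) p))
    (λ {i} p q _ _ pq → subst₂ _≢_ (cycleColouring-vertex i p) (cycleColouring-vertex i q)
                                  (cycleColouring-proper (ks≥2 i) p q pq))
    where
    r-proper = proj₁ (proj₂ reserved-proper)
    cycleColouring-vertex : ∀ i p → cycleColouring (lookup ks i) p ≡
                                     uncurry (cycleColouring ∘ lookup ks) (position ks (vertex ks i p))
    cycleColouring-vertex i p = cong (uncurry (cycleColouring ∘ lookup ks)) (sym (position-vertex ks i p))

  straighten-misses : ∀ {g} → IsTwistedColouring g → ¬ (∀ u → straighten g u ≡ missedColouring u)
  straighten-misses {g} g-twisted st≗missed = Merge.merge-off-diagonal c₀ {restrict onA g} {restrict onB g}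
    (subst (λ x → T (twistedB πa x (restrict onA g))) apex (restrictA-twisted g-twisted))
    (subst (λ x → T (twistedB πb x (restrict onB g))) apex (restrictB-twisted g-twisted))
    {r} (proj₂ (proj₂ reserved-proper))
    (begin
      merge c₀ (restrictions g)                  ≡⟨ cong (λ x → merge x (restrictions g)) apex ⟨
      merged g                                   ≡⟨ restrictions-rebuild (g zero) (merged g) (g ∘ suc) ⟨
      restrictions (straighten g)                ≡⟨ restrictions-cong st≗missed ⟩
      restrictions missedColouring               ≡⟨ restrictions-rebuild c₀ (r , r) _ ⟩
      (r , r)                                    ∎)
    where
    open ≡-Reasoning
    r = proj₁ reserved-proper
    apex : g zero ≡ c₀
    apex = st≗missed zero

  properColouringOf : Subset (size M * 4) → Vec (Fin 4) (size M)
  properColouringOf S = tabulate (straighten (colouringOf S))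

  fewer-colourings : #colorings cover < P M 4
  -- The implicit arguments are given explicitly: inferring them makes Agda normalise the enumerations.
  fewer-colourings = countB-<-by-injection (≡-dec _≟_)
    {p = colouringB} {q = properB M}
    {xs = allVecs (true ∷ false ∷ []) (size M * 4)} {ys = allVecs (allFin 4) (size M)}
    (allVecs-unique bools! (size M * 4)) (allVecs-complete ∈-allFin (size M))
    properColouringOf
    (λ S S-col → properB-tabulate M (straighten (colouringOf S)) (straighten-proper (twisted S S-col)))
    (λ S S′ S-col S′-col eq → colouringOf-injective {S} {S′} S-col S′-col
       (straighten-injective (twisted S S-col) (twisted S′ S′-col)
          (tabulate-injective {f = straighten (colouringOf S)} {straighten (colouringOf S′)} eq)))
    (tabulate missedColouring) (properB-tabulate M missedColouring missedColouring-proper)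
    (λ S S-col eq → straighten-misses (twisted S S-col)
                      (tabulate-injective {f = straighten (colouringOf S)} {missedColouring} eq))
    where
    bools! : Unique (true ∷ false ∷ [])
    bools! = ((λ ()) ∷ []) ∷ [] ∷ []
    twisted : ∀ S → T (colouringB S) → IsTwistedColouring (colouringOf S)
    twisted S = colouringOf-twisted {S}

not-TauAdmissible : ∀ {G m} (c : Cover G m) → #colorings c < P G m → ∀ N → N ≤ m → ¬ TauAdmissible G N
not-TauAdmissible {m = m} c fewer N N≤m (_ , P≡P-DP) = <⇒≱ fewer (proj₂ (P≡P-DP m N≤m) c)

proposition3p18 : (n : ℕ) (ks : Vec ℕ n) → 2 ≤ n → (∀ i → 3 ≤ lookup ks i) →
    (a b : Fin n) → a ≢ b → lookup ks a ≡ 4 → lookup ks b ≡ 4 →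
    Σ (Cover (K1∨ cycles ks) 4) (λ c → #colorings c < P (K1∨ cycles ks) 4)
    × (∀ N → N ≤ 4 → ¬ TauAdmissible (K1∨ cycles ks) N)
-- 2 ≤ n is implied by a ≢ b.
proposition3p18 n ks _ ks≥3 a b a≢b ka kb =
  (cover , fewer-colourings) , not-TauAdmissible cover fewer-colourings
  where open Construction ks (λ i → ≤-trans (n≤1+n 2) (ks≥3 i)) a b a≢b ka kb
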